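{- Let $r$ and $k$ be positive integers. Let $H$ be a simple edge-coloured graph in which each colour class has size at most $r$. Let $R$ be an excess-$k$ rainbow subgraph of $H$ such that $V(R)$ is minimal under inclusion, i.e. there is no excess-$k$ rainbow subgraph $R'$ of $H$ with $V(R') \subsetneq V(R)$. Then $H$ contains a rainbow $2$-cycle, or there are at most $\max\{\binom{2k+2}{2}, 6k(r-1)\}$ chords of $R$ in $H$.
   Context: Graphs may have parallel edges. An edge-coloured graph is simple if no colour class contains two parallel edges (edges of different colours may be parallel). A subgraph is rainbow if no two of its edges have the same colour; a rainbow $2$-cycle is a pair of parallel edges of different colours. A graph is excess-$k$ if it has at least $k$ more edges than vertices. A chord of $R$ in $H$ is an edge of $H$ not in $R$ whose both ends lie in $V(R)$. -}

module Defs where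

open import Data.Nat using (ℕ; _+_; _≤_; _≟_)
open import Data.Fin using (Fin)
open import Data.Fin.Subset using (Subset; _∈_; _∉_; _⊂_; ∣_∣)
open import Data.Fin.Subset.Properties using (_∈?_)
open import Data.Vec using (tabulate)
open import Data.Product using (_×_; _,_; proj₁; proj₂; Σ)
open import Data.Sum using (_⊎_)
open import Relation.Binary.PropositionalEquality using (_≡_)
open import Relation.Nullary using (¬_)
open import Relation.Nullary.Decidable using (⌊_⌋; _×-dec_; ¬?)

-- An edge-coloured (loopless) multigraph on vertex set Fin n with edge set Fin m.
-- Parallel edges are allowed: distinct edges may have the same ends.
record ECGraph (n m : ℕ) : Set where
  field
    end₁   : Fin m → Fin n
    end₂   : Fin m → Fin n
    loopless : ∀ e → ¬ (end₁ e ≡ end₂ e)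
    colour : Fin m → ℕ
open ECGraph public

module _ {n m : ℕ} (H : ECGraph n m) where

  SameEnds : Fin m → Fin m → Set
  SameEnds e f = (end₁ H e ≡ end₁ H f × end₂ H e ≡ end₂ H f)
               ⊎ (end₁ H e ≡ end₂ H f × end₂ H e ≡ end₁ H f)

  IsSimple : Set
  IsSimple = ∀ e f → ¬ (e ≡ f) → SameEnds e f → ¬ (colour H e ≡ colour H f)

  colourClass : ℕ → Subset m
  colourClass c = tabulate (λ e → ⌊ colour H e ≟ c ⌋)

  ColourClassesAtMost : ℕ → Set
  ColourClassesAtMost r = ∀ c → ∣ colourClass c ∣ ≤ r

  HasRainbow2Cycle : Set
  HasRainbow2Cycle = Σ (Fin m) λ e → Σ (Fin m) λ f →
    SameEnds e f × ¬ (colour H e ≡ colour H f)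

  record Subgraph : Set where
    field
      V : Subset n
      E : Subset m
      closed : ∀ e → e ∈ E → end₁ H e ∈ V × end₂ H e ∈ V
  open Subgraph public

  IsRainbow : Subgraph → Set
  IsRainbow R = ∀ e f → e ∈ E R → f ∈ E R → colour H e ≡ colour H f → e ≡ f

  IsExcess : ℕ → Subgraph → Set
  IsExcess k R = ∣ V R ∣ + k ≤ ∣ E R ∣

  VertexMinimal : ℕ → Subgraph → Set
  VertexMinimal k R = ∀ (R' : Subgraph) → IsExcess k R' → IsRainbow R' → ¬ (V R' ⊂ V R)

  chords : Subgraph → Subset m
  chords R = tabulate (λ e → ⌊ ¬? (e ∈? E R) ×-dec (end₁ H e ∈? V R) ×-dec (end₂ H e ∈? V R) ⌋)

-- Let v = |V(R)|. Deleting a vertex x of V(R) with its edges from a rainbow edge set S on V(R)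
-- gives a rainbow subgraph on fewer vertices, which by minimality is not excess-k; hence
-- |S| + 2 ≤ v + k + deg_S x.
--
-- Without rainbow 2-cycles the simple graph H has no parallel edges at all, so if v ≤ 2k + 2
-- there are at most C(2k+2, 2) chords. If v > 2k + 2, summing the deletion inequality over
-- V(R) shows that every rainbow S on V(R) has at most v + k edges. So each chord e has an
-- edge f of R of its colour (else R + e is too big), and f has an end of R-degree at least 3:
-- otherwise R - f + e is again excess-k and rainbow, so it has minimum degree 2, which forces
-- e to meet both ends of f, i.e. e ∥ f against simplicity. Since Σ (deg_R − 2) = 2k, at most
-- 3 · 2k edges of R have such an end, and each is the partner of at most r − 1 chords.
module Submission where

open import Data.Nat.Properties hiding (_≟_)
open import Algebra.Properties.Semiring.Sum +-*-semiring
  using (sum; sum-syntax; ∑-comm; ∑-distrib-+; *-distribˡ-sum; sum-cong-≗; sum-replicate-zero; sum-remove)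
open import Data.Bool using (Bool; true; false; _∧_; _∨_; not; if_then_else_)
import Data.Bool as Bool
open import Data.Bool.Properties using (∧-conicalˡ; ∧-conicalʳ; ∧-zeroʳ; ∧-identityʳ; ∨-zeroʳ; ∨-identityʳ)
open import Data.Fin using (Fin; zero; suc; _≟_; punchIn)
open import Data.Fin.Properties using (any?; punchInᵢ≢i)
open import Data.Fin.Subset using (Subset; _∈_; _⊂_; ∣_∣)
open import Data.Fin.Subset.Properties using (_∈?_)
open import Data.Nat using (ℕ; zero; suc; _+_; _*_; _∸_; _≤_; _<_; _⊔_; z≤n; s≤s; _≤?_)
import Data.Nat as ℕ
open import Data.Nat.Combinatorics using (_C_; nC1≡n; nCk+nC[k+1]≡[n+1]C[k+1])
open import Data.Nat.Tactic.RingSolver using (solve-∀)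
open import Data.Product using (_×_; _,_; proj₁; proj₂; ∃-syntax)
open import Data.Sum using (_⊎_; inj₁; inj₂)
open import Data.Vec using ([]; _∷_; lookup; tabulate)
open import Data.Vec.Properties using (lookup∘tabulate; []=⇒lookup; lookup⇒[]=)
open import Function using (_∘_)
open import Relation.Binary.PropositionalEquality
open import Relation.Nullary using (¬_; yes; no; Dec; does; contradiction)
open import Relation.Nullary.Decidable using (⌊_⌋; dec-true; dec-false; isYes≗does; _×-dec_; _⊎-dec_; ¬?)

open import Defs

sum-zero : ∀ {n} {f : Fin n → ℕ} → (∀ i → f i ≡ 0) → sum f ≡ 0
sum-zero {n} z = trans (sum-cong-≗ z) (sum-replicate-zero n)

sum-mono-≤ : ∀ {n} {f g : Fin n → ℕ} → (∀ i → f i ≤ g i) → sum f ≤ sum g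
sum-mono-≤ {zero}  _  = z≤n
sum-mono-≤ {suc n} le = +-mono-≤ (le zero) (sum-mono-≤ (le ∘ suc))

sum-point : ∀ {n} {f : Fin n → ℕ} (i : Fin n) → (∀ j → j ≢ i → f j ≡ 0) → sum f ≡ f i
sum-point {suc n} {f} i z = begin
  sum f                                ≡⟨ sum-remove f ⟩
  f i + sum (λ j → f (punchIn i j))    ≡⟨ cong (f i +_) (sum-zero (λ j → z _ (punchInᵢ≢i i j))) ⟩
  f i + 0                              ≡⟨ +-identityʳ (f i) ⟩
  f i                                  ∎
  where open ≡-Reasoning

sum-if : ∀ {n} b (f : Fin n → ℕ) → (if b then sum f else 0) ≡ sum (λ j → if b then f j else 0)
sum-if true  f = refl
sum-if {n} false f = sym (sum-zero {n} λ _ → refl)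

does≡true⇒ : ∀ {a} {A : Set a} (a? : Dec A) → does a? ≡ true → A
does≡true⇒ (yes a) _ = a

does≡false⇒ : ∀ {a} {A : Set a} (a? : Dec A) → does a? ≡ false → ¬ A
does≡false⇒ (no ¬a) _ = ¬a

-- Vertex and edge sets are Boolean predicates on Fin; the Subset vectors of the statement
-- are read through lookup.
infixr 7 _∩_
infixr 6 _∪_ _─_

⁅_⁆ : ∀ {n} → Fin n → Fin n → Bool
⁅ i ⁆ j = does (i ≟ j)

_∩_ _∪_ _─_ : ∀ {n} → (Fin n → Bool) → (Fin n → Bool) → Fin n → Bool
(p ∩ q) i = p i ∧ q i
(p ∪ q) i = p i ∨ q i
(p ─ q) i = p i ∧ not (q i)

insert delete : ∀ {n} → Fin n → (Fin n → Bool) → Fin n → Bool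
insert i p = p ∪ ⁅ i ⁆
delete i p = p ─ ⁅ i ⁆

⁅i⁆i : ∀ {n} (i : Fin n) → ⁅ i ⁆ i ≡ true
⁅i⁆i i = dec-true (i ≟ i) refl

⁅i⁆j : ∀ {n} {i j : Fin n} → i ≢ j → ⁅ i ⁆ j ≡ false
⁅i⁆j {i = i} {j} i≢j = dec-false (i ≟ j) i≢j

⁅i⁆j⇒i≡j : ∀ {n} {i j : Fin n} → ⁅ i ⁆ j ≡ true → i ≡ j
⁅i⁆j⇒i≡j {i = i} {j} = does≡true⇒ (i ≟ j)

∈-insert⁻ : ∀ {n} {i j : Fin n} (p : Fin n → Bool) → insert i p j ≡ true → p j ≡ true ⊎ i ≡ j
∈-insert⁻ {i = i} {j} p j∈ with p j
... | true  = inj₁ refl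
... | false = inj₂ (⁅i⁆j⇒i≡j j∈)

∈-delete⁻ : ∀ {n} {i j : Fin n} (p : Fin n → Bool) → delete i p j ≡ true → p j ≡ true × i ≢ j
∈-delete⁻ {i = i} {j} p j∈ with p j | i ≟ j
... | true | no i≢j = refl , i≢j

delete⁺ : ∀ {n} {i j : Fin n} {p : Fin n → Bool} → p j ≡ true → i ≢ j → delete i p j ≡ true
delete⁺ {p = p} p[j] i≢j rewrite ⁅i⁆j i≢j = trans (∧-identityʳ _) p[j]

χ : Bool → ℕ
χ b = if b then 1 else 0

∑∈ : ∀ {n} → (Fin n → Bool) → (Fin n → ℕ) → ℕ
∑∈ p w = sum (λ i → if p i then w i else 0)

syntax ∑∈ p (λ i → w) = ∑[ i ∈ p ] w

count : ∀ {n} → (Fin n → Bool) → ℕ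
count p = ∑[ i ∈ p ] 1

∑∈-cong : ∀ {n} {p : Fin n → Bool} {w u} → (∀ i → p i ≡ true → w i ≡ u i) → ∑∈ p w ≡ ∑∈ p u
∑∈-cong {p = p} {w} {u} eq = sum-cong-≗ pointwise
  where
  pointwise : ∀ i → (if p i then w i else 0) ≡ (if p i then u i else 0)
  pointwise i with p i in p[i]
  ... | true  = eq i p[i]
  ... | false = refl

∑∈-congˡ : ∀ {n} {p q : Fin n → Bool} {w} → (∀ i → p i ≡ q i) → ∑∈ p w ≡ ∑∈ q w
∑∈-congˡ {w = w} eq = sum-cong-≗ λ i → cong (λ b → if b then w i else 0) (eq i)

∑∈-mono-≤ : ∀ {n} {p : Fin n → Bool} {w u} → (∀ i → p i ≡ true → w i ≤ u i) → ∑∈ p w ≤ ∑∈ p u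
∑∈-mono-≤ {p = p} {w} {u} le = sum-mono-≤ pointwise
  where
  pointwise : ∀ i → (if p i then w i else 0) ≤ (if p i then u i else 0)
  pointwise i with p i in p[i]
  ... | true  = le i p[i]
  ... | false = z≤n

∑∈-mono-⊆ : ∀ {n} {p q : Fin n → Bool} {w} → (∀ i → p i ≡ true → q i ≡ true) → ∑∈ p w ≤ ∑∈ q w
∑∈-mono-⊆ {p = p} {q} {w} p⊆q = sum-mono-≤ pointwise
  where
  pointwise : ∀ i → (if p i then w i else 0) ≤ (if q i then w i else 0)
  pointwise i with p i in p[i]
  ... | true  rewrite p⊆q i p[i] = ≤-refl
  ... | false = z≤n

∑∈-+ : ∀ {n} (p : Fin n → Bool) w u → ∑[ i ∈ p ] (w i + u i) ≡ ∑∈ p w + ∑∈ p u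
∑∈-+ {n} p w u = trans (sum-cong-≗ pointwise) (∑-distrib-+ {n} _ _)
  where
  pointwise : ∀ i → (if p i then w i + u i else 0) ≡ (if p i then w i else 0) + (if p i then u i else 0)
  pointwise i with p i
  ... | true  = refl
  ... | false = refl

∑∈-*ˡ : ∀ {n} (p : Fin n → Bool) c w → ∑[ i ∈ p ] (c * w i) ≡ c * ∑∈ p w
∑∈-*ˡ {n} p c w = sym (trans (*-distribˡ-sum {n} c _) (sum-cong-≗ pointwise))
  where
  pointwise : ∀ i → c * (if p i then w i else 0) ≡ (if p i then c * w i else 0)
  pointwise i with p i
  ... | true  = refl
  ... | false = *-zeroʳ c

∑∈-const : ∀ {n} (p : Fin n → Bool) c → ∑[ i ∈ p ] c ≡ c * count p
∑∈-const p c = trans (∑∈-cong {p = p} (λ _ _ → sym (*-identityʳ c))) (∑∈-*ˡ p c (λ _ → 1))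

∑∈-∩ : ∀ {n} (p q : Fin n → Bool) w → ∑∈ (p ∩ q) w ≡ ∑[ i ∈ p ] (if q i then w i else 0)
∑∈-∩ p q w = sum-cong-≗ pointwise
  where
  pointwise : ∀ i → (if p i ∧ q i then w i else 0) ≡ (if p i then (if q i then w i else 0) else 0)
  pointwise i with p i
  ... | true  = refl
  ... | false = refl

∑∈-split : ∀ {n} (p q : Fin n → Bool) w → ∑∈ p w ≡ ∑∈ (p ─ q) w + ∑∈ (p ∩ q) w
∑∈-split {n} p q w = trans (sum-cong-≗ pointwise) (∑-distrib-+ {n} _ _)
  where
  pointwise : ∀ i → (if p i then w i else 0)
                  ≡ (if p i ∧ not (q i) then w i else 0) + (if p i ∧ q i then w i else 0)
  pointwise i with p i | q i
  ... | true  | true  = refl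
  ... | true  | false = sym (+-identityʳ (w i))
  ... | false | _     = refl

∑∈-point : ∀ {n} {p : Fin n → Bool} {i} w → p i ≡ true → ∑∈ (p ∩ ⁅ i ⁆) w ≡ w i
∑∈-point {p = p} {i} w p[i] = begin
  ∑∈ (p ∩ ⁅ i ⁆) w                          ≡⟨ sum-point i off-i ⟩
  (if p i ∧ ⁅ i ⁆ i then w i else 0)        ≡⟨ cong₂ (λ a b → if a ∧ b then w i else 0) p[i] (⁅i⁆i i) ⟩
  w i                                       ∎
  where
  open ≡-Reasoning
  off-i : ∀ j → j ≢ i → (if p j ∧ ⁅ i ⁆ j then w j else 0) ≡ 0
  off-i j j≢i rewrite ⁅i⁆j (j≢i ∘ sym) with p j
  ... | true  = refl
  ... | false = refl

∑∈-delete : ∀ {n} {p : Fin n → Bool} {i} w → p i ≡ true → ∑∈ p w ≡ ∑∈ (delete i p) w + w i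
∑∈-delete {p = p} {i} w p[i] = trans (∑∈-split p ⁅ i ⁆ w) (cong (∑∈ (delete i p) w +_) (∑∈-point w p[i]))

∑∈-insert : ∀ {n} {p : Fin n → Bool} {i} w → p i ≡ false → ∑∈ (insert i p) w ≡ ∑∈ p w + w i
∑∈-insert {p = p} {i} w p[i] =
  trans (∑∈-delete w (trans (cong (p i ∨_) (⁅i⁆i i)) (∨-zeroʳ (p i)))) (cong (_+ w i) (∑∈-congˡ pointwise))
  where
  pointwise : ∀ j → delete i (insert i p) j ≡ p j
  pointwise j with i ≟ j
  ... | yes refl = trans (∧-zeroʳ _) (sym p[i])
  ... | no  _    = trans (∧-identityʳ _) (∨-identityʳ (p j))

∈⇒≤∑∈ : ∀ {n} {p : Fin n → Bool} {i} w → p i ≡ true → w i ≤ ∑∈ p w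
∈⇒≤∑∈ {p = p} {i} w p[i] = ≤-trans (≤-reflexive (sym (∑∈-point {p = p} w p[i]))) (∑∈-mono-⊆ {p = p ∩ ⁅ i ⁆} (λ j → ∧-conicalˡ _ _))

count≤1 : ∀ {n} {p : Fin n → Bool} → (∀ i j → p i ≡ true → p j ≡ true → i ≡ j) → count p ≤ 1
count≤1 {n} {p} unique with any? (λ i → p i Bool.≟ true)
... | yes (i , p[i]) = ≤-trans (∑∈-mono-⊆ {p = p} {q = ⁅ i ⁆} (λ j p[j] → dec-true (i ≟ j) (unique i j p[i] p[j])))
                               (≤-reflexive (∑∈-point {p = λ _ → true} {i} (λ _ → 1) refl))
... | no  ∄i         = ≤-trans (∑∈-mono-⊆ {p = p} {q = λ _ → false} (λ j p[j] → contradiction (j , p[j]) ∄i))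
                               (≤-trans (≤-reflexive (sum-zero {n} {λ _ → 0} λ _ → refl)) z≤n)

∑∈-comm : ∀ {a b} (p : Fin a → Bool) (q : Fin b → Bool) (w : Fin a → Fin b → ℕ) →
          ∑[ i ∈ p ] ∑[ j ∈ q ] w i j ≡ ∑[ j ∈ q ] ∑[ i ∈ p ] w i j
∑∈-comm {a} {b} p q w = begin
  ∑[ i ∈ p ] ∑[ j ∈ q ] w i j                                          ≡⟨ sum-cong-≗ (λ i → sum-if (p i) (λ j → if q j then w i j else 0)) ⟩
  ∑[ i < a ] ∑[ j < b ] (if p i then (if q j then w i j else 0) else 0)  ≡⟨ ∑-comm (λ i j → if p i then (if q j then w i j else 0) else 0) ⟩
  ∑[ j < b ] ∑[ i < a ] (if p i then (if q j then w i j else 0) else 0)  ≡⟨ sum-cong-≗ (λ j → sum-cong-≗ (λ i → if-swap (p i) (q j))) ⟩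
  ∑[ j < b ] ∑[ i < a ] (if q j then (if p i then w i j else 0) else 0)  ≡⟨ sum-cong-≗ (λ j → sum-if (q j) (λ i → if p i then w i j else 0)) ⟨
  ∑[ j ∈ q ] ∑[ i ∈ p ] w i j                                          ∎
  where
  open ≡-Reasoning
  if-swap : ∀ x y {c} → (if x then (if y then c else 0) else 0) ≡ (if y then (if x then c else 0) else 0)
  if-swap true  y     = refl
  if-swap false true  = refl
  if-swap false false = refl

double-counting : ∀ {a b} (A : Fin a → Bool) (B : Fin b → Bool) (ρ : Fin a → Fin b → Bool) (c : Fin b → ℕ) →
                  (∀ i → A i ≡ true → ∃[ j ] B j ≡ true × ρ i j ≡ true) →
                  (∀ j → B j ≡ true → count (A ∩ λ i → ρ i j) ≤ c j) →
                  count A ≤ ∑∈ B c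
double-counting A B ρ c partner bounded = begin
  count A                             ≤⟨ ∑∈-mono-≤ at-least-one ⟩
  ∑[ i ∈ A ] ∑[ j ∈ B ] χ (ρ i j)     ≡⟨ ∑∈-comm A B _ ⟩
  ∑[ j ∈ B ] ∑[ i ∈ A ] χ (ρ i j)     ≡⟨ ∑∈-cong {p = B} (λ j _ → ∑∈-∩ A (λ i → ρ i j) (λ _ → 1)) ⟨
  ∑[ j ∈ B ] count (A ∩ λ i → ρ i j)  ≤⟨ ∑∈-mono-≤ bounded ⟩
  ∑∈ B c                              ∎
  where
  open ≤-Reasoning
  at-least-one : ∀ i → A i ≡ true → 1 ≤ ∑[ j ∈ B ] χ (ρ i j)
  at-least-one i A[i] with partner i A[i]
  ... | j , B[j] , ρ[i,j] = subst (_≤ ∑[ j ∈ B ] χ (ρ i j)) (cong χ ρ[i,j]) (∈⇒≤∑∈ {p = B} (λ j → χ (ρ i j)) B[j])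

∣p∣≡count : ∀ {n} (p : Subset n) → ∣ p ∣ ≡ count (lookup p)
∣p∣≡count []          = refl
∣p∣≡count (true ∷ p)  = cong suc (∣p∣≡count p)
∣p∣≡count (false ∷ p) = ∣p∣≡count p

∣tabulate∣≡count : ∀ {n} (f : Fin n → Bool) → ∣ tabulate f ∣ ≡ count f
∣tabulate∣≡count f = trans (∣p∣≡count (tabulate f)) (∑∈-congˡ (lookup∘tabulate f))

∈⇒lookup : ∀ {n} {p : Subset n} {x} → x ∈ p → lookup p x ≡ true
∈⇒lookup = []=⇒lookup

∉⇒lookup : ∀ {n} {p : Subset n} {x} → ¬ x ∈ p → lookup p x ≡ false
∉⇒lookup {p = p} {x} x∉p with lookup p x in p[x]
... | true  = contradiction (lookup⇒[]= x p p[x]) x∉p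
... | false = refl

lookup⇒∈ : ∀ {n} {p : Subset n} {x} → lookup p x ≡ true → x ∈ p
lookup⇒∈ {p = p} {x} = lookup⇒[]= x p

∈-tabulate⁺ : ∀ {n} {f : Fin n → Bool} {x} → f x ≡ true → x ∈ tabulate f
∈-tabulate⁺ {f = f} {x} f[x] = lookup⇒∈ (trans (lookup∘tabulate f x) f[x])

∈-tabulate⁻ : ∀ {n} {f : Fin n → Bool} {x} → x ∈ tabulate f → f x ≡ true
∈-tabulate⁻ {f = f} {x} x∈ = trans (sym (lookup∘tabulate f x)) (∈⇒lookup x∈)

2*[nC2]≡[n∸1]*n : ∀ n → 2 * (n C 2) ≡ (n ∸ 1) * n
2*[nC2]≡[n∸1]*n zero    = refl
2*[nC2]≡[n∸1]*n (suc n) = begin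
  2 * (suc n C 2)            ≡⟨ cong (2 *_) (nCk+nC[k+1]≡[n+1]C[k+1] n 1) ⟨
  2 * (n C 1 + n C 2)        ≡⟨ *-distribˡ-+ 2 (n C 1) (n C 2) ⟩
  2 * (n C 1) + 2 * (n C 2)  ≡⟨ cong₂ (λ a b → 2 * a + b) (nC1≡n n) (2*[nC2]≡[n∸1]*n n) ⟩
  2 * n + (n ∸ 1) * n        ≡⟨ step n ⟩
  n * suc n                  ∎
  where
  open ≡-Reasoning
  expand : ∀ n → 2 * suc n + n * suc n ≡ suc n * suc (suc n)
  expand = solve-∀
  step : ∀ n → 2 * n + (n ∸ 1) * n ≡ n * suc n
  step zero    = refl
  step (suc n) = expand n

module _ {n m : ℕ} (H : ECGraph n m) where

  incident : Fin m → Fin n → Bool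
  incident e = ⁅ end₁ H e ⁆ ∪ ⁅ end₂ H e ⁆

  deg : (Fin m → Bool) → Fin n → ℕ
  deg es x = ∑[ e ∈ es ] χ (incident e x)

  Closed : (Fin n → Bool) → (Fin m → Bool) → Set
  Closed vs es = ∀ e → es e ≡ true → vs (end₁ H e) ≡ true × vs (end₂ H e) ≡ true

  Rainbow : (Fin m → Bool) → Set
  Rainbow es = ∀ e f → es e ≡ true → es f ≡ true → colour H e ≡ colour H f → e ≡ f

  end₁-incident : ∀ {e x} → end₁ H e ≡ x → incident e x ≡ true
  end₁-incident {e} refl = cong (_∨ ⁅ end₂ H e ⁆ (end₁ H e)) (⁅i⁆i (end₁ H e))

  end₂-incident : ∀ {e x} → end₂ H e ≡ x → incident e x ≡ true
  end₂-incident {e} refl = trans (cong (⁅ end₁ H e ⁆ (end₂ H e) ∨_) (⁅i⁆i (end₂ H e))) (∨-zeroʳ _)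

  incident⇒end : ∀ {e x} → incident e x ≡ true → end₁ H e ≡ x ⊎ end₂ H e ≡ x
  incident⇒end {e} {x} e∋x with end₁ H e ≟ x
  ... | yes e₁≡x = inj₁ e₁≡x
  ... | no  _    = inj₂ (⁅i⁆j⇒i≡j e∋x)

  incident-pair : ∀ {e x y} → x ≢ y → incident e x ≡ true → incident e y ≡ true →
                  (end₁ H e ≡ x × end₂ H e ≡ y) ⊎ (end₁ H e ≡ y × end₂ H e ≡ x)
  incident-pair {e} x≢y e∋x e∋y with incident⇒end e∋x | incident⇒end e∋y
  ... | inj₁ e₁≡x | inj₁ e₁≡y = contradiction (trans (sym e₁≡x) e₁≡y) x≢y
  ... | inj₁ e₁≡x | inj₂ e₂≡y = inj₁ (e₁≡x , e₂≡y)
  ... | inj₂ e₂≡x | inj₁ e₁≡y = inj₂ (e₁≡y , e₂≡x)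
  ... | inj₂ e₂≡x | inj₂ e₂≡y = contradiction (trans (sym e₂≡x) e₂≡y) x≢y

  incident-pair⇒SameEnds : ∀ {e f x y} → x ≢ y →
                           incident e x ≡ true → incident e y ≡ true →
                           incident f x ≡ true → incident f y ≡ true → SameEnds H e f
  incident-pair⇒SameEnds x≢y e∋x e∋y f∋x f∋y
    with incident-pair x≢y e∋x e∋y | incident-pair x≢y f∋x f∋y
  ... | inj₁ (a , b) | inj₁ (c , d) = inj₁ (trans a (sym c) , trans b (sym d))
  ... | inj₁ (a , b) | inj₂ (c , d) = inj₂ (trans a (sym d) , trans b (sym c))
  ... | inj₂ (a , b) | inj₁ (c , d) = inj₂ (trans a (sym d) , trans b (sym c))
  ... | inj₂ (a , b) | inj₂ (c , d) = inj₁ (trans a (sym c) , trans b (sym d))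

  ∑∈-incident≡2 : ∀ {vs} e → vs (end₁ H e) ≡ true → vs (end₂ H e) ≡ true → ∑[ x ∈ vs ] χ (incident e x) ≡ 2
  ∑∈-incident≡2 {vs} e a∈ b∈ = begin
    ∑[ x ∈ vs ] χ (incident e x)                  ≡⟨ ∑∈-cong {p = vs} (λ x _ → χ-∨ x) ⟩
    ∑[ x ∈ vs ] (χ (⁅ a ⁆ x) + χ (⁅ b ⁆ x))        ≡⟨ ∑∈-+ vs _ _ ⟩
    ∑[ x ∈ vs ] χ (⁅ a ⁆ x) + ∑[ x ∈ vs ] χ (⁅ b ⁆ x)
      ≡⟨ cong₂ _+_ (trans (sym (∑∈-∩ vs ⁅ a ⁆ _)) (∑∈-point {p = vs} _ a∈))
                   (trans (sym (∑∈-∩ vs ⁅ b ⁆ _)) (∑∈-point {p = vs} _ b∈)) ⟩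
    2                                             ∎
    where
    open ≡-Reasoning
    a b : Fin n
    a = end₁ H e
    b = end₂ H e
    χ-∨ : ∀ x → χ (incident e x) ≡ χ (⁅ a ⁆ x) + χ (⁅ b ⁆ x)
    χ-∨ x with a ≟ x | b ≟ x
    ... | yes a≡x  | yes b≡x  = contradiction (trans a≡x (sym b≡x)) (loopless H e)
    ... | yes _    | no  _    = refl
    ... | no  _    | yes _    = refl
    ... | no  _    | no  _    = refl

  handshake : ∀ {vs es} → Closed vs es → ∑[ x ∈ vs ] deg es x ≡ 2 * count es
  handshake {vs} {es} closed = begin
    ∑[ x ∈ vs ] ∑[ e ∈ es ] χ (incident e x)  ≡⟨ ∑∈-comm vs es _ ⟩
    ∑[ e ∈ es ] ∑[ x ∈ vs ] χ (incident e x)  ≡⟨ ∑∈-cong {p = es} (λ e e∈ → ∑∈-incident≡2 {vs} e (proj₁ (closed e e∈)) (proj₂ (closed e e∈))) ⟩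
    ∑[ e ∈ es ] 2                             ≡⟨ ∑∈-const es 2 ⟩
    2 * count es                              ∎
    where open ≡-Reasoning

  subgraph : (vs : Fin n → Bool) (es : Fin m → Bool) → Closed vs es → Subgraph H
  subgraph vs es closed = record
    { V = tabulate vs
    ; E = tabulate es
    ; closed = λ e e∈ → let a∈ , b∈ = closed e (∈-tabulate⁻ e∈) in ∈-tabulate⁺ a∈ , ∈-tabulate⁺ b∈
    }

  closed-⊆ : ∀ {vs es es′} → (∀ e → es′ e ≡ true → es e ≡ true) → Closed vs es → Closed vs es′
  closed-⊆ es′⊆es closed e e∈ = closed e (es′⊆es e e∈)

  rainbow-⊆ : ∀ {es es′} → (∀ e → es′ e ≡ true → es e ≡ true) → Rainbow es → Rainbow es′
  rainbow-⊆ es′⊆es rainbow e f e∈ f∈ = rainbow e f (es′⊆es e e∈) (es′⊆es f f∈)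

  closed-insert : ∀ {vs es e} → Closed vs es → vs (end₁ H e) ≡ true × vs (end₂ H e) ≡ true →
                  Closed vs (insert e es)
  closed-insert {es = es} {e} closed ends g g∈ with ∈-insert⁻ {i = e} es g∈
  ... | inj₁ g∈es = closed g g∈es
  ... | inj₂ refl = ends

  rainbow-insert : ∀ {es e} → Rainbow es → (∀ g → es g ≡ true → colour H g ≢ colour H e) →
                   Rainbow (insert e es)
  rainbow-insert {es} {e} rainbow new-colour g h g∈ h∈ same with ∈-insert⁻ {i = e} es g∈ | ∈-insert⁻ {i = e} es h∈
  ... | inj₁ g∈es | inj₁ h∈es = rainbow g h g∈es h∈es same
  ... | inj₁ g∈es | inj₂ refl = contradiction same (new-colour g g∈es)
  ... | inj₂ refl | inj₁ h∈es = contradiction (sym same) (new-colour h h∈es)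
  ... | inj₂ refl | inj₂ refl = refl

  same-colour : Fin m → Fin m → Bool
  same-colour f e = does (colour H e ℕ.≟ colour H f)

  count-same-colour-others : ∀ {r} → ColourClassesAtMost H r → ∀ f → count (delete f (same-colour f)) ≤ r ∸ 1
  count-same-colour-others {r} bounded f = m+n≤o⇒m≤o∸n _ (begin
    count (delete f (same-colour f)) + 1  ≡⟨ ∑∈-delete {p = same-colour f} (λ _ → 1) (dec-true (colour H f ℕ.≟ colour H f) refl) ⟨
    count (same-colour f)                 ≡⟨ ∑∈-congˡ (λ e → isYes≗does (colour H e ℕ.≟ colour H f)) ⟨
    count (λ e → ⌊ colour H e ℕ.≟ colour H f ⌋) ≡⟨ ∣tabulate∣≡count (λ e → ⌊ colour H e ℕ.≟ colour H f ⌋) ⟨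
    ∣ colourClass H (colour H f) ∣         ≤⟨ bounded (colour H f) ⟩
    r                                     ∎)
    where open ≤-Reasoning

  no-parallel-edges : IsSimple H → ¬ HasRainbow2Cycle H → ∀ e f → SameEnds H e f → e ≡ f
  no-parallel-edges simple no-2-cycle e f parallel with e ≟ f | colour H e ℕ.≟ colour H f
  ... | yes e≡f | _        = e≡f
  ... | no  e≢f | yes same = contradiction same (simple e f e≢f parallel)
  ... | no  _   | no  diff = contradiction (e , f , parallel , diff) no-2-cycle

  deg≤count∸1 : ∀ {vs es} → (∀ e f → SameEnds H e f → e ≡ f) → Closed vs es →
                ∀ {x} → vs x ≡ true → deg es x ≤ count vs ∸ 1
  deg≤count∸1 {vs} {es} no-parallel closed {x} x∈ = begin
    deg es x                                  ≡⟨ ∑∈-∩ es (λ e → incident e x) (λ _ → 1) ⟨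
    count (es ∩ λ e → incident e x)           ≤⟨ double-counting (es ∩ λ e → incident e x) (delete x vs) incident (λ _ → 1) other-end at-most-one ⟩
    count (delete x vs)                       ≡⟨ m+n∸n≡m _ 1 ⟨
    count (delete x vs) + 1 ∸ 1               ≡⟨ cong (_∸ 1) (∑∈-delete {p = vs} (λ _ → 1) x∈) ⟨
    count vs ∸ 1                              ∎
    where
    open ≤-Reasoning
    other-end : ∀ e → (es ∩ λ e → incident e x) e ≡ true → ∃[ y ] delete x vs y ≡ true × incident e y ≡ true
    other-end e e∈ with incident⇒end (∧-conicalʳ _ _ e∈) | closed e (∧-conicalˡ _ _ e∈)
    ... | inj₁ e₁≡x | _ , e₂∈ = end₂ H e , delete⁺ {p = vs} e₂∈ (λ x≡e₂ → loopless H e (trans e₁≡x x≡e₂)) , end₂-incident refl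
    ... | inj₂ e₂≡x | e₁∈ , _ = end₁ H e , delete⁺ {p = vs} e₁∈ (λ x≡e₁ → loopless H e (sym (trans e₂≡x x≡e₁))) , end₁-incident refl
    at-most-one : ∀ y → delete x vs y ≡ true → count ((es ∩ λ e → incident e x) ∩ λ e → incident e y) ≤ 1
    at-most-one y y∈ = count≤1 {p = (es ∩ λ e → incident e x) ∩ λ e → incident e y} λ e f e∈ f∈ →
      let e∋x , e∋y = at-x-and-y e e∈ ; f∋x , f∋y = at-x-and-y f f∈
      in no-parallel e f (incident-pair⇒SameEnds (proj₂ (∈-delete⁻ {i = x} vs y∈)) e∋x e∋y f∋x f∋y)
      where
      at-x-and-y : ∀ e → ((es ∩ λ e → incident e x) ∩ λ e → incident e y) e ≡ true →
                   incident e x ≡ true × incident e y ≡ true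
      at-x-and-y e e∈ = ∧-conicalʳ (es e) (incident e x) (∧-conicalˡ (es e ∧ incident e x) (incident e y) e∈)
                      , ∧-conicalʳ (es e ∧ incident e x) (incident e y) e∈

  2*count≤[count∸1]*count : ∀ {vs es} → (∀ e f → SameEnds H e f → e ≡ f) → Closed vs es →
                            2 * count es ≤ (count vs ∸ 1) * count vs
  2*count≤[count∸1]*count {vs} {es} no-parallel closed = begin
    2 * count es              ≡⟨ handshake closed ⟨
    ∑[ x ∈ vs ] deg es x      ≤⟨ ∑∈-mono-≤ {p = vs} (λ x x∈ → deg≤count∸1 no-parallel closed x∈) ⟩
    ∑[ x ∈ vs ] (count vs ∸ 1) ≡⟨ ∑∈-const vs (count vs ∸ 1) ⟩
    (count vs ∸ 1) * count vs ∎
    where open ≤-Reasoning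

  count≤C2 : ∀ {vs es N} → (∀ e f → SameEnds H e f → e ≡ f) → Closed vs es → count vs ≤ N → count es ≤ N C 2
  count≤C2 {vs} {es} {N} no-parallel closed few = *-cancelˡ-≤ 2 (begin
    2 * count es               ≤⟨ 2*count≤[count∸1]*count no-parallel closed ⟩
    (count vs ∸ 1) * count vs  ≤⟨ *-mono-≤ (∸-monoˡ-≤ 1 few) few ⟩
    (N ∸ 1) * N                ≡⟨ 2*[nC2]≡[n∸1]*n N ⟨
    2 * (N C 2)                ∎)
    where open ≤-Reasoning

  subgraph-closed : (R : Subgraph H) → Closed (lookup (V R)) (lookup (E R))
  subgraph-closed R e e∈ = let a∈ , b∈ = closed R e (lookup⇒∈ e∈) in ∈⇒lookup a∈ , ∈⇒lookup b∈

2*[v+k+1+t]<[3+t]*v : ∀ v k t → 2 * k + 2 < v → 2 * (v + k + 1 + t) < (3 + t) * v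
2*[v+k+1+t]<[3+t]*v v k t large = begin-strict
  2 * (v + k + 1 + t)         <⟨ n<1+n _ ⟩
  suc (2 * (v + k + 1 + t))   ≡⟨ expand-left v k t ⟩
  v + v + suc (2 * k + 2) + t * 2 ≤⟨ +-mono-≤ (+-monoʳ-≤ (v + v) large) (*-monoʳ-≤ t two≤v) ⟩
  v + v + v + t * v           ≡⟨ expand-right v t ⟩
  (3 + t) * v                 ∎
  where
  open ≤-Reasoning
  two≤v : 2 ≤ v
  two≤v = ≤-trans (≤-trans (m≤n+m 2 (2 * k)) (n≤1+n _)) large
  expand-left : ∀ v k t → suc (2 * (v + k + 1 + t)) ≡ v + v + suc (2 * k + 2) + t * 2
  expand-left = solve-∀
  expand-right : ∀ v t → v + v + v + t * v ≡ (3 + t) * v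
  expand-right = solve-∀

d≤3*[d∸2] : ∀ {d} → 3 ≤ d → d ≤ 3 * (d ∸ 2)
d≤3*[d∸2] {suc (suc (suc j))} (s≤s (s≤s (s≤s _))) = ≤-trans (m≤m+n (3 + j) (2 * j)) (≤-reflexive (regroup j))
  where
  regroup : ∀ j → 3 + j + 2 * j ≡ 3 * (1 + j)
  regroup = solve-∀

-- Vertex-minimal excess-k rainbow subgraphs

module MinimalRainbowSubgraph {n m} (H : ECGraph n m) (k : ℕ) (R : Subgraph H)
                     (excess : IsExcess H k R) (rainbow : IsRainbow H R) (minimal : VertexMinimal H k R) where

  vR : Fin n → Bool
  vR = lookup (V R)

  eR : Fin m → Bool
  eR = lookup (E R)

  v : ℕ
  v = count vR

  closedR : Closed H vR eR
  closedR = subgraph-closed H R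

  rainbowR : Rainbow H eR
  rainbowR e f e∈ f∈ = rainbow e f (lookup⇒∈ e∈) (lookup⇒∈ f∈)

  excessR : v + k ≤ count eR
  excessR = subst₂ (λ a b → a + k ≤ b) (∣p∣≡count (V R)) (∣p∣≡count (E R)) excess

  vertex-deletion : ∀ {es} → Closed H vR es → Rainbow H es → ∀ {x} → vR x ≡ true →
                    2 + count es ≤ v + k + deg H es x
  vertex-deletion {es} closed rainbow-es {x} x∈ = begin
    2 + count es                      ≡⟨ cong (2 +_) edges ⟩
    suc (suc (count es′) + d)         ≤⟨ s≤s (+-monoˡ-≤ d not-excess) ⟩
    suc (count vs′ + k + d)           ≡⟨ cong (λ z → z + k + d) (trans (+-comm 1 (count vs′)) (sym vertices)) ⟩
    v + k + d                         ∎
    where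
    open ≤-Reasoning
    d : ℕ
    d = deg H es x
    vs′ : Fin n → Bool
    vs′ = delete x vR
    es′ : Fin m → Bool
    es′ = es ─ λ e → incident H e x
    vertices : v ≡ count vs′ + 1
    vertices = ∑∈-delete {p = vR} (λ _ → 1) x∈
    edges : count es ≡ count es′ + d
    edges = trans (∑∈-split es (λ e → incident H e x) (λ _ → 1)) (cong (count es′ +_) (∑∈-∩ es _ (λ _ → 1)))
    closed′ : Closed H vs′ es′
    closed′ e e∈ =
      let e₁∈ , e₂∈ = closed e (∧-conicalˡ (es e) _ e∈)
      in delete⁺ {p = vR} e₁∈ (misses-x e e∈ (end₁-incident H refl)) , delete⁺ {p = vR} e₂∈ (misses-x e e∈ (end₂-incident H refl))
      where
      misses-x : ∀ e → es′ e ≡ true → ∀ {y} → incident H e y ≡ true → x ≢ y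
      misses-x e e∈ e∋y refl = contradiction (trans (sym (cong not e∋y)) (∧-conicalʳ (es e) _ e∈)) λ ()
    R′ : Subgraph H
    R′ = subgraph H vs′ es′ closed′
    R′⊂R : V R′ ⊂ V R
    R′⊂R = (λ y∈ → lookup⇒∈ (proj₁ (∈-delete⁻ {i = x} vR (∈-tabulate⁻ y∈))))
         , x , lookup⇒∈ x∈ , λ x∈R′ → proj₂ (∈-delete⁻ {i = x} vR (∈-tabulate⁻ x∈R′)) refl
    not-excess : count es′ < count vs′ + k
    not-excess = ≰⇒> λ excess′ → minimal R′
      (subst₂ (λ a b → a + k ≤ b) (sym (∣tabulate∣≡count vs′)) (sym (∣tabulate∣≡count es′)) excess′)
      (λ e f e∈ f∈ → rainbow-es e f (∧-conicalˡ _ _ (∈-tabulate⁻ e∈)) (∧-conicalˡ _ _ (∈-tabulate⁻ f∈)))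
      R′⊂R

  min-degree : ∀ {es} → Closed H vR es → Rainbow H es → v + k ≤ count es → ∀ {x} → vR x ≡ true → 2 ≤ deg H es x
  min-degree {es} closed rainbow-es excess-es x∈ = +-cancelʳ-≤ (count es) 2 (deg H es _) (begin
    2 + count es        ≤⟨ vertex-deletion closed rainbow-es x∈ ⟩
    v + k + deg H es _  ≤⟨ +-monoˡ-≤ _ excess-es ⟩
    count es + deg H es _ ≡⟨ +-comm (count es) _ ⟩
    deg H es _ + count es ∎)
    where open ≤-Reasoning

  rainbow-edge-bound : 2 * k + 2 < v → ∀ {es} → Closed H vR es → Rainbow H es → count es ≤ v + k
  rainbow-edge-bound large {es} closed rainbow-es with count es ≤? v + k
  ... | yes bounded   = bounded
  ... | no  unbounded = contradiction degree-sum (<⇒≱ (2*[v+k+1+t]<[3+t]*v v k t large))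
    where
    t : ℕ
    t = count es ∸ (v + k + 1)
    edges : count es ≡ v + k + 1 + t
    edges = sym (m+[n∸m]≡n (subst (_≤ count es) (+-comm 1 (v + k)) (≰⇒> unbounded)))
    high-degree : ∀ x → vR x ≡ true → 3 + t ≤ deg H es x
    high-degree x x∈ = +-cancelˡ-≤ (v + k) _ _ (begin
      v + k + (3 + t)           ≡⟨ shuffle v k t ⟩
      2 + (v + k + 1 + t)       ≡⟨ cong (2 +_) edges ⟨
      2 + count es              ≤⟨ vertex-deletion closed rainbow-es x∈ ⟩
      v + k + deg H es x        ∎)
      where
      open ≤-Reasoning
      shuffle : ∀ v k t → v + k + (3 + t) ≡ 2 + (v + k + 1 + t)
      shuffle = solve-∀
    degree-sum : (3 + t) * v ≤ 2 * (v + k + 1 + t)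
    degree-sum = begin
      (3 + t) * v                 ≡⟨ ∑∈-const vR (3 + t) ⟨
      ∑[ x ∈ vR ] (3 + t)         ≤⟨ ∑∈-mono-≤ {p = vR} high-degree ⟩
      ∑[ x ∈ vR ] deg H es x      ≡⟨ handshake H closed ⟩
      2 * count es                ≡⟨ cong (2 *_) edges ⟩
      2 * (v + k + 1 + t)         ∎
      where open ≤-Reasoning

  cR : Fin m → Bool
  cR = lookup (chords H R)

  chord⁻ : ∀ {e} → cR e ≡ true → eR e ≡ false × vR (end₁ H e) ≡ true × vR (end₂ H e) ≡ true
  chord⁻ {e} e∈ =
    let e∉R , e₁∈ , e₂∈ = does≡true⇒ chord? (trans (sym (isYes≗does chord?)) (trans (sym (lookup∘tabulate _ e)) e∈))
    in ∉⇒lookup e∉R , ∈⇒lookup e₁∈ , ∈⇒lookup e₂∈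
    where
    chord? : Dec (¬ e ∈ E R × end₁ H e ∈ V R × end₂ H e ∈ V R)
    chord? = ¬? (e ∈? E R) ×-dec (end₁ H e ∈? V R) ×-dec (end₂ H e ∈? V R)

  module Large (large : 2 * k + 2 < v) where

    chord-partner : ∀ {e} → cR e ≡ true → ∃[ f ] eR f ≡ true × colour H f ≡ colour H e
    chord-partner {e} e∈ with any? (λ f → (eR f Bool.≟ true) ×-dec (colour H f ℕ.≟ colour H e))
    ... | yes found = found
    ... | no  none  = contradiction (rainbow-edge-bound large closed′ rainbow′) (<⇒≱ grown)
      where
      closed′ : Closed H vR (insert e eR)
      closed′ = closed-insert H {vR} {eR} {e} closedR (proj₂ (chord⁻ e∈))
      rainbow′ : Rainbow H (insert e eR)
      rainbow′ = rainbow-insert H rainbowR (λ g g∈ same → none (g , g∈ , same))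
      grown : v + k < count (insert e eR)
      grown = subst (v + k <_) (trans (+-comm 1 (count eR)) (sym (∑∈-insert {p = eR} (λ _ → 1) (proj₁ (chord⁻ e∈)))))
                    (s≤s excessR)

    -- Swapping f for e keeps R rainbow and excess-k, so min-degree applies to R - f + e at x.
    chord-meets-light-end : ∀ {e f x} → cR e ≡ true → eR f ≡ true → colour H f ≡ colour H e →
                    vR x ≡ true → incident H f x ≡ true → deg H eR x ≤ 2 → incident H e x ≡ true
    chord-meets-light-end {e} {f} {x} e∈ f∈ same x∈ f∋x low with incident H e x in e∋x
    ... | true  = refl
    ... | false = contradiction (min-degree closedS rainbowS excessS x∈) (<⇒≱ (begin
        suc (deg H S x)  ≡⟨ +-comm 1 (deg H S x) ⟩
        deg H S x + 1    ≡⟨ degrees ⟩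
        deg H eR x       ≤⟨ low ⟩
        2                ∎))
      where
      open ≤-Reasoning
      D S : Fin m → Bool
      D = delete f eR
      S = insert e D
      e∉D : D e ≡ false
      e∉D = cong (_∧ not (⁅ f ⁆ e)) (proj₁ (chord⁻ e∈))
      D⊆R : ∀ g → D g ≡ true → eR g ≡ true
      D⊆R g = ∧-conicalˡ (eR g) _
      closedS : Closed H vR S
      closedS = closed-insert H {vR} {D} {e} (closed-⊆ H {vR} {eR} {D} D⊆R closedR) (proj₂ (chord⁻ e∈))
      rainbowS : Rainbow H S
      rainbowS = rainbow-insert H (rainbow-⊆ H D⊆R rainbowR) λ g g∈ same′ →
        proj₂ (∈-delete⁻ {i = f} eR g∈) (sym (rainbowR g f (D⊆R g g∈) f∈ (trans same′ (sym same))))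
      excessS : v + k ≤ count S
      excessS = subst (v + k ≤_) (trans (∑∈-delete {p = eR} (λ _ → 1) f∈) (sym (∑∈-insert {p = D} (λ _ → 1) e∉D))) excessR
      degrees : deg H S x + 1 ≡ deg H eR x
      degrees = begin-equality
        deg H S x + 1                        ≡⟨ cong (_+ 1) (∑∈-insert {p = D} (λ g → χ (incident H g x)) e∉D) ⟩
        deg H D x + χ (incident H e x) + 1   ≡⟨ cong (λ b → deg H D x + χ b + 1) e∋x ⟩
        deg H D x + 0 + 1                    ≡⟨ cong₂ (λ a b → a + χ b) (+-identityʳ (deg H D x)) (sym f∋x) ⟩
        deg H D x + χ (incident H f x)       ≡⟨ ∑∈-delete {p = eR} (λ g → χ (incident H g x)) f∈ ⟨
        deg H eR x                           ∎

    heavy : Fin n → Bool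
    heavy x = does (3 ≤? deg H eR x)

    heavy-edges : Fin m → Bool
    heavy-edges f = eR f ∧ (heavy (end₁ H f) ∨ heavy (end₂ H f))

    heavy⇒3≤deg : ∀ {x} → heavy x ≡ true → 3 ≤ deg H eR x
    heavy⇒3≤deg = does≡true⇒ (3 ≤? _)

    chord-partner-heavy : IsSimple H → ∀ {e f} → cR e ≡ true → eR f ≡ true → colour H f ≡ colour H e → heavy-edges f ≡ true
    chord-partner-heavy simple {e} {f} e∈ f∈ same with heavy (end₁ H f) in h₁ | heavy (end₂ H f) in h₂
    ... | true  | _     = cong (_∧ true) f∈
    ... | false | true  = cong (_∧ true) f∈
    ... | false | false = contradiction (sym same) (simple e f e≢f parallel)
      where
      e≢f : e ≢ f
      e≢f refl = contradiction (trans (sym f∈) (proj₁ (chord⁻ e∈))) λ ()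
      light : ∀ {x} → heavy x ≡ false → deg H eR x ≤ 2
      light = ≤-pred ∘ ≰⇒> ∘ does≡false⇒ (3 ≤? _)
      parallel : SameEnds H e f
      parallel = incident-pair⇒SameEnds H (loopless H f)
        (chord-meets-light-end e∈ f∈ same (proj₁ (closedR f f∈)) (end₁-incident H refl) (light h₁))
        (chord-meets-light-end e∈ f∈ same (proj₂ (closedR f f∈)) (end₂-incident H refl) (light h₂))
        (end₁-incident H refl) (end₂-incident H refl)

    surplus-degree : ∑[ x ∈ vR ] (deg H eR x ∸ 2) ≤ 2 * k
    surplus-degree = +-cancelʳ-≤ (2 * v) _ _ (begin
      ∑[ x ∈ vR ] (deg H eR x ∸ 2) + 2 * v                  ≡⟨ cong (∑[ x ∈ vR ] (deg H eR x ∸ 2) +_) (∑∈-const vR 2) ⟨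
      ∑[ x ∈ vR ] (deg H eR x ∸ 2) + ∑[ x ∈ vR ] 2         ≡⟨ ∑∈-+ vR (λ x → deg H eR x ∸ 2) (λ _ → 2) ⟨
      ∑[ x ∈ vR ] (deg H eR x ∸ 2 + 2)                      ≡⟨ ∑∈-cong {p = vR} (λ x x∈ → m∸n+n≡m (min-degree closedR rainbowR excessR x∈)) ⟩
      ∑[ x ∈ vR ] deg H eR x                                ≡⟨ handshake H closedR ⟩
      2 * count eR                                          ≤⟨ *-monoʳ-≤ 2 (rainbow-edge-bound large closedR rainbowR) ⟩
      2 * (v + k)                                           ≡⟨ *-distribˡ-+ 2 v k ⟩
      2 * v + 2 * k                                         ≡⟨ +-comm (2 * v) (2 * k) ⟩
      2 * k + 2 * v                                         ∎)
      where open ≤-Reasoning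

    heavy-edge-count : count heavy-edges ≤ 6 * k
    heavy-edge-count = begin
      count heavy-edges                                 ≤⟨ double-counting heavy-edges (vR ∩ heavy) (incident H) (deg H eR) heavy-end at-most-deg ⟩
      ∑[ x ∈ vR ∩ heavy ] deg H eR x               ≤⟨ ∑∈-mono-≤ {p = vR ∩ heavy} (λ x x∈ → d≤3*[d∸2] (heavy⇒3≤deg (∧-conicalʳ (vR x) _ x∈))) ⟩
      ∑[ x ∈ vR ∩ heavy ] (3 * (deg H eR x ∸ 2))   ≤⟨ ∑∈-mono-⊆ {p = vR ∩ heavy} {vR} (λ x → ∧-conicalˡ (vR x) _) ⟩
      ∑[ x ∈ vR ] (3 * (deg H eR x ∸ 2))           ≡⟨ ∑∈-*ˡ vR 3 (λ x → deg H eR x ∸ 2) ⟩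
      3 * ∑[ x ∈ vR ] (deg H eR x ∸ 2)             ≤⟨ *-monoʳ-≤ 3 surplus-degree ⟩
      3 * (2 * k)                                  ≡⟨ *-assoc 3 2 k ⟨
      6 * k                                        ∎
      where
      open ≤-Reasoning
      heavy-end : ∀ f → heavy-edges f ≡ true → ∃[ x ] (vR ∩ heavy) x ≡ true × incident H f x ≡ true
      heavy-end f f∈ with heavy (end₁ H f) in h₁ | closedR f (∧-conicalˡ (eR f) _ f∈)
      ... | true  | e₁∈ , _ = end₁ H f , cong₂ _∧_ e₁∈ h₁ , end₁-incident H refl
      ... | false | _ , e₂∈ = end₂ H f , cong₂ _∧_ e₂∈ (trans (cong (_∨ heavy (end₂ H f)) (sym h₁)) (∧-conicalʳ (eR f) _ f∈))
                            , end₂-incident H refl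
      at-most-deg : ∀ x → (vR ∩ heavy) x ≡ true → count (heavy-edges ∩ λ f → incident H f x) ≤ deg H eR x
      at-most-deg x _ = ≤-trans (∑∈-mono-⊆ {p = heavy-edges ∩ λ f → incident H f x} {eR ∩ λ f → incident H f x} in-star)
                                (≤-reflexive (∑∈-∩ eR (λ f → incident H f x) (λ _ → 1)))
        where
        in-star : ∀ f → (heavy-edges ∩ λ f → incident H f x) f ≡ true → (eR ∩ λ f → incident H f x) f ≡ true
        in-star f f∈ = cong₂ _∧_ (∧-conicalˡ (eR f) _ (∧-conicalˡ (heavy-edges f) _ f∈)) (∧-conicalʳ (heavy-edges f) _ f∈)

    chord-count : ∀ {r} → IsSimple H → ColourClassesAtMost H r → count cR ≤ 6 * k * (r ∸ 1)
    chord-count {r} simple bounded = begin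
      count cR                  ≤⟨ double-counting cR heavy-edges (λ e f → delete f (same-colour H f) e) (λ _ → r ∸ 1) partner few ⟩
      ∑[ f ∈ heavy-edges ] (r ∸ 1)   ≡⟨ ∑∈-const heavy-edges (r ∸ 1) ⟩
      (r ∸ 1) * count heavy-edges    ≤⟨ *-monoʳ-≤ (r ∸ 1) heavy-edge-count ⟩
      (r ∸ 1) * (6 * k)         ≡⟨ *-comm (r ∸ 1) (6 * k) ⟩
      6 * k * (r ∸ 1)           ∎
      where
      open ≤-Reasoning
      partner : ∀ e → cR e ≡ true → ∃[ f ] heavy-edges f ≡ true × delete f (same-colour H f) e ≡ true
      partner e e∈ =
        let f , f∈ , same = chord-partner e∈
            e≢f : e ≢ f
            e≢f e≡f = contradiction (trans (sym f∈) (trans (cong eR (sym e≡f)) (proj₁ (chord⁻ e∈)))) λ ()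
        in f , chord-partner-heavy simple e∈ f∈ same
             , delete⁺ {p = same-colour H f} (dec-true (colour H e ℕ.≟ colour H f) (sym same)) (e≢f ∘ sym)
      few : ∀ f → heavy-edges f ≡ true → count (cR ∩ λ e → delete f (same-colour H f) e) ≤ r ∸ 1
      few f _ = ≤-trans (∑∈-mono-⊆ {p = cR ∩ λ e → delete f (same-colour H f) e} {delete f (same-colour H f)}
                                   (λ e → ∧-conicalʳ (cR e) _))
                        (count-same-colour-others H bounded f)

hasRainbow2Cycle? : ∀ {n m} (H : ECGraph n m) → Dec (HasRainbow2Cycle H)
hasRainbow2Cycle? H = any? λ e → any? λ f → sameEnds? e f ×-dec ¬? (colour H e ℕ.≟ colour H f)
  where
  sameEnds? : ∀ e f → Dec (SameEnds H e f)
  sameEnds? e f = (end₁ H e ≟ end₁ H f ×-dec end₂ H e ≟ end₂ H f) ⊎-dec (end₁ H e ≟ end₂ H f ×-dec end₂ H e ≟ end₁ H f)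

lemma3p5 : (r k : ℕ) → 1 ≤ r → 1 ≤ k → {n m : ℕ} → (H : ECGraph n m) →
    IsSimple H → ColourClassesAtMost H r →
    (R : Subgraph H) → IsExcess H k R → IsRainbow H R → VertexMinimal H k R →
    HasRainbow2Cycle H ⊎ ∣ chords H R ∣ ≤ ((2 * k + 2) C 2) ⊔ (6 * k * (r ∸ 1))
lemma3p5 r k _ _ H simple bounded R excess rainbow minimal with hasRainbow2Cycle? H
... | yes cycle    = inj₁ cycle
... | no  no-cycle = inj₂ (subst (_≤ _) (sym (∣p∣≡count (chords H R))) chord-bound)
  where
  open MinimalRainbowSubgraph H k R excess rainbow minimal
  chord-bound : count cR ≤ ((2 * k + 2) C 2) ⊔ (6 * k * (r ∸ 1))
  chord-bound with v ≤? 2 * k + 2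
  ... | yes small = ≤-trans (count≤C2 H (no-parallel-edges H simple no-cycle) (λ e → proj₂ ∘ chord⁻) small) (m≤m⊔n _ _)
  ... | no  large = ≤-trans (Large.chord-count (≰⇒> large) simple bounded) (m≤n⊔m _ _)
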